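{- Every graph which contains a loose odd wheel as an induced subgraph is $t$-imperfect (i.e. not $t$-perfect).
   Context: All graphs are finite, simple and undirected. A graph $G$ is $t$-perfect if the polytope in $\mathbb{R}^{V(G)}$ defined by $x_v\ge 0$ for every $v\in V(G)$, $x_u+x_v\le 1$ for every edge $uv\in E(G)$, and $\sum_{v\in V(C)}x_v\le (|V(C)|-1)/2$ for every induced odd cycle $C$ of $G$, is integral. A loose wheel is a graph formed by a cycle $C$ and a vertex $v\notin V(C)$ that has at least three neighbours on $C$ (and no other edges); a segment of the loose wheel is a path of $C$ joining two neighbours of $v$ and containing no other neighbour of $v$. A loose odd wheel is a loose wheel in which $C$ has odd length and at least three of the segments have odd length. -}

module Defs where

open import Data.Nat using (ℕ; zero; suc; _+_; _∸_; _<_; _≤_; _%_; NonZero)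
open import Data.Bool using (Bool; true; false)
open import Data.Fin using (Fin; toℕ) renaming (zero to fzero; suc to fsuc)
open import Data.Integer using (ℤ; +_)
open import Data.Rational using (ℚ; _/_; 0ℚ; 1ℚ) renaming (_+_ to _+ℚ_; _*_ to _*ℚ_; _≤_ to _≤ℚ_)
open import Data.Product using (Σ; ∃; _×_; _,_)
open import Relation.Binary.PropositionalEquality using (_≡_; _≢_)
open import Relation.Nullary using (¬_)
open import Data.Sum using (_⊎_)
open import Function using (_⇔_)

record Graph (n : ℕ) : Set where
  field
    adj   : Fin n → Fin n → Bool
    sym   : ∀ u v → adj u v ≡ adj v u
    irrfl : ∀ v → adj v v ≡ false
open Graph public

Injective : ∀ {m n} → (Fin m → Fin n) → Set
Injective f = ∀ i j → f i ≡ f j → i ≡ j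

Odd : ℕ → Set
Odd k = k % 2 ≡ 1

shift : ∀ {k} → Fin k → ℕ → ℕ
shift {suc k} i d = (toℕ i + d) % suc k

CycAdj : (k : ℕ) → Fin k → Fin k → Set
CycAdj k i j = shift i 1 ≡ toℕ j ⊎ shift j 1 ≡ toℕ i

InducedCycle : ∀ {n} → Graph n → (k : ℕ) → (Fin k → Fin n) → Set
InducedCycle G k c =
  3 ≤ k × Injective c × (∀ i j → (adj G (c i) (c j) ≡ true) ⇔ CycAdj k i j)

AtLeast3 : ∀ {k} → (Fin k → Set) → Set
AtLeast3 {k} P = Σ (Fin k) λ a → Σ (Fin k) λ b → Σ (Fin k) λ c →
  a ≢ b × a ≢ c × b ≢ c × P a × P b × P c

-- S i ≡ true means the hub is adjacent to c_i.
-- For a hub-neighbour c_i, the segment starting at c_i is the path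
-- c_i c_{i+1} ... c_{i+d} (indices mod k) where c_{i+d} is the next
-- neighbour of the hub along the cycle; its length is d.  Segments are in
-- bijection with the neighbours of the hub (their starting points).

OddSegmentAt : ∀ {k} → (Fin k → Bool) → Fin k → Set
OddSegmentAt {k} S i =
  S i ≡ true ×
  Σ ℕ λ d → 1 ≤ d × Odd d ×
    (Σ (Fin k) λ j → toℕ j ≡ shift i d × S j ≡ true) ×
    (∀ e → 1 ≤ e → e < d → ∀ (j : Fin k) → toℕ j ≡ shift i e → S j ≡ false)

-- G contains a loose odd wheel as an induced subgraph: an induced odd cycle
-- c of G and a vertex h outside it with at least three neighbours on it,
-- such that at least three segments are odd.  (Being an induced cycle plus
-- h's adjacencies to the c_i describe exactly the subgraph of G induced on
-- V(C) ∪ {h}.)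
ContainsLooseOddWheel : ∀ {n} → Graph n → Set
ContainsLooseOddWheel {n} G =
  Σ ℕ λ k → Σ (Fin k → Fin n) λ c → Σ (Fin n) λ h →
    InducedCycle G k c × Odd k × (∀ i → h ≢ c i) ×
    AtLeast3 (λ i → adj G h (c i) ≡ true) ×
    AtLeast3 (OddSegmentAt (λ i → adj G h (c i)))

sumℚ : ∀ {m} → (Fin m → ℚ) → ℚ
sumℚ {zero}  f = 0ℚ
sumℚ {suc m} f = f fzero +ℚ sumℚ (λ i → f (fsuc i))

InTSTAB : ∀ {n} → Graph n → (Fin n → ℚ) → Set
InTSTAB {n} G x =
  (∀ v → 0ℚ ≤ℚ x v) ×
  (∀ u v → adj G u v ≡ true → (x u +ℚ x v) ≤ℚ 1ℚ) ×
  (∀ k (c : Fin k → Fin n) → InducedCycle G k c → Odd k →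
     sumℚ (λ i → x (c i)) ≤ℚ ((+ (k ∸ 1)) / 2))

toℚ : ℤ → ℚ
toℚ z = z / 1

Integral : ∀ {n} → ((Fin n → ℚ) → Set) → Set
Integral {n} P =
  ∀ x → P x →
    Σ ℕ λ m → Σ (Fin m → Fin n → ℤ) λ p → Σ (Fin m → ℚ) λ lam →
      (∀ j → P (λ v → toℚ (p j v))) ×
      (∀ j → 0ℚ ≤ℚ lam j) ×
      sumℚ lam ≡ 1ℚ ×
      (∀ v → x v ≡ sumℚ (λ j → lam j *ℚ toℚ (p j v)))

TPerfect : ∀ {n} → Graph n → Set
TPerfect G = Integral (InTSTAB G)

module Submission where

-- Let C be the rim, of odd length k = K + 1, and h the hub. Every stable set of the wheel
-- satisfies x(C) + x(h) ≤ K/2: without h this is the odd-cycle inequality of C; with h it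
-- misses the ends of all segments, so each odd segment contains an edge of C with both ends
-- missed. These three edges are distinct, so at most k − 3 edges of C meet the stable set, each
-- in one vertex, and it has at most (k − 3)/2 vertices on C. The point x that is 1/k on h and
-- K/2k on C violates this inequality by 1/k but lies in TSTAB(G): an odd cycle through a vertex
-- off C has weight at most (2 + (k′ − 1)K)/2k, and an odd cycle inside C has length at least
-- k, since C minus a vertex is a path and carries no closed walk of odd length.

open import Defs hiding (sym)
open import Algebra.Bundles using (Ring)
import Algebra.Properties.Semiring.Sum as SemiringSum
open import Data.Bool using (Bool; true; false)
open import Data.Empty using (⊥; ⊥-elim)
open import Data.Fin using (Fin; toℕ; punchIn; _≟_) renaming (zero to fzero; suc to fsuc)
open import Data.Fin.Properties
  using (toℕ-inject₁; toℕ-fromℕ; toℕ-fromℕ<; toℕ-injective; toℕ<n; ¬∀⟶∃¬; any?; all?; injective⇒≤)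
open import Data.Integer as ℤ using (ℤ; +_; -[1+_])
import Data.Integer.Properties as ℤP
import Data.Integer.Tactic.RingSolver as ℤSolver
open import Data.Nat using (ℕ; zero; suc; _+_; _*_; _∸_; _%_; _≤_; _<_; z≤n; s≤s; parity)
open import Data.Nat.DivMod using (_mod_; m%n<n; m<n⇒m%n≡m; n%n≡0; %-distribˡ-+; m%n%n≡m%n; [m+kn]%n≡m%n)
import Data.Nat.Properties as ℕP
open import Data.Nat.Tactic.RingSolver using (solve-∀)
open import Data.Parity.Base using (Parity; _⁻¹)
import Data.Parity.Properties as ℙP
open import Data.Product using (∃; _×_; _,_; proj₁; proj₂)
open import Data.Rational using (ℚ; _/_; 0ℚ; 1ℚ; toℚᵘ; nonNegative)
  renaming (_+_ to _+ℚ_; _*_ to _*ℚ_; _≤_ to _≤ℚ_)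
import Data.Rational.Properties as ℚP
open import Data.Rational.Unnormalised as ℚᵘ using (mkℚᵘ; *≤*; *≡*)
import Data.Rational.Unnormalised.Properties as ℚᵘP
open import Data.Sum using (_⊎_; inj₁; inj₂)
open import Data.Vec.Functional using (removeAt)
open import Function using (_∘_; Equivalence)
open import Relation.Binary.PropositionalEquality
open import Relation.Nullary using (¬_; yes; no)

open SemiringSum ℕP.+-*-semiring using (sum; sum-cong-≗; sum-init-last; sum-remove; ∑-distrib-+)
private module ℚΣ = SemiringSum (Ring.semiring ℚP.+-*-ring)

-- Finite sums

sum-const : ∀ m a → sum {m} (λ _ → a) ≡ m * a
sum-const zero    a = refl
sum-const (suc m) a = cong (_+_ a) (sum-const m a)

sum-≤-* : ∀ {m} (f : Fin m → ℕ) M → (∀ i → f i ≤ M) → sum f ≤ m * M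
sum-≤-* {zero}  f M f≤M = z≤n
sum-≤-* {suc m} f M f≤M = ℕP.+-mono-≤ (f≤M fzero) (sum-≤-* (f ∘ fsuc) M (f≤M ∘ fsuc))

sum-rotate : ∀ m (g : ℕ → ℕ) → g 0 + sum {m} (λ i → g (suc (toℕ i))) ≡ sum {m} (λ i → g (toℕ i)) + g m
sum-rotate m g = trans (sum-init-last {m} (λ i → g (toℕ i)))
  (cong₂ _+_ (sum-cong-≗ {m} (λ i → cong g (toℕ-inject₁ i))) (cong g (toℕ-fromℕ m)))

sum-≤-+* : ∀ {m} (f : Fin (suc m) → ℕ) i a M → f i ≤ a → (∀ j → f j ≤ M) → sum f ≤ a + m * M
sum-≤-+* f i a M fi≤a f≤M = ℕP.≤-trans (ℕP.≤-reflexive (sum-remove {i = i} f))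
  (ℕP.+-mono-≤ fi≤a (sum-≤-* (removeAt f i) M (λ j → f≤M (punchIn i j))))

private
  δ : ∀ {m} → Fin m → Fin m → ℕ
  δ fzero    fzero    = 1
  δ fzero    (fsuc _) = 0
  δ (fsuc _) fzero    = 0
  δ (fsuc z) (fsuc i) = δ z i

  sum-δ : ∀ {m} (z : Fin m) → sum (δ z) ≡ 1
  sum-δ {suc m} fzero    = cong suc (trans (sum-const m 0) (ℕP.*-zeroʳ m))
  sum-δ {suc m} (fsuc z) = sum-δ z

  δ-self : ∀ {m} (z : Fin m) → δ z z ≡ 1
  δ-self fzero    = refl
  δ-self (fsuc z) = δ-self z

  δ-≢ : ∀ {m} {z i : Fin m} → z ≢ i → δ z i ≡ 0
  δ-≢ {z = fzero}  {fzero}  z≢i = ⊥-elim (z≢i refl)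
  δ-≢ {z = fzero}  {fsuc _} z≢i = refl
  δ-≢ {z = fsuc _} {fzero}  z≢i = refl
  δ-≢ {z = fsuc z} {fsuc i} z≢i = δ-≢ (z≢i ∘ cong fsuc)

sum+3≤ : ∀ {m} (f : Fin m → ℕ) → (∀ i → f i ≤ 1) → ∀ z₁ z₂ z₃ → z₁ ≢ z₂ → z₁ ≢ z₃ → z₂ ≢ z₃ →
         f z₁ ≡ 0 → f z₂ ≡ 0 → f z₃ ≡ 0 → sum f + 3 ≤ m
sum+3≤ {m} f f≤1 z₁ z₂ z₃ z₁≢z₂ z₁≢z₃ z₂≢z₃ fz₁≡0 fz₂≡0 fz₃≡0 = begin
  sum f + 3      ≡⟨ sum-g ⟨
  sum g          ≤⟨ sum-≤-* g 1 g≤1 ⟩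
  m * 1          ≡⟨ ℕP.*-identityʳ m ⟩
  m              ∎
  where
  open ℕP.≤-Reasoning
  g : Fin m → ℕ
  g i = f i + (δ z₁ i + (δ z₂ i + δ z₃ i))
  sum-g : sum g ≡ sum f + 3
  sum-g = trans (∑-distrib-+ f _) (cong (_+_ (sum f)) (trans (∑-distrib-+ (δ z₁) _)
            (cong₂ _+_ (sum-δ z₁) (trans (∑-distrib-+ (δ z₂) (δ z₃)) (cong₂ _+_ (sum-δ z₂) (sum-δ z₃))))))
  g≤1 : ∀ i → g i ≤ 1
  g≤1 i with z₁ ≟ i | z₂ ≟ i | z₃ ≟ i
  ... | yes refl | yes refl | _        = ⊥-elim (z₁≢z₂ refl)
  ... | yes refl | _        | yes refl = ⊥-elim (z₁≢z₃ refl)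
  ... | _        | yes refl | yes refl = ⊥-elim (z₂≢z₃ refl)
  ... | yes refl | no z₂≢i  | no z₃≢i  =
    ℕP.≤-reflexive (cong₂ _+_ fz₁≡0 (cong₂ _+_ (δ-self z₁) (cong₂ _+_ (δ-≢ z₂≢i) (δ-≢ z₃≢i))))
  ... | no z₁≢i  | yes refl | no z₃≢i  =
    ℕP.≤-reflexive (cong₂ _+_ fz₂≡0 (cong₂ _+_ (δ-≢ z₁≢i) (cong₂ _+_ (δ-self z₂) (δ-≢ z₃≢i))))
  ... | no z₁≢i  | no z₂≢i  | yes refl =
    ℕP.≤-reflexive (cong₂ _+_ fz₃≡0 (cong₂ _+_ (δ-≢ z₁≢i) (cong₂ _+_ (δ-≢ z₂≢i) (δ-self z₃))))
  ... | no z₁≢i  | no z₂≢i  | no z₃≢i  =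
    subst (_≤ 1) (cong (_+_ (f i)) (sym (cong₂ _+_ (δ-≢ z₁≢i) (cong₂ _+_ (δ-≢ z₂≢i) (δ-≢ z₃≢i)))))
          (subst (_≤ 1) (sym (ℕP.+-identityʳ (f i))) (f≤1 i))

sumℚ≡sum : ∀ {m} (f : Fin m → ℚ) → sumℚ f ≡ ℚΣ.sum f
sumℚ≡sum {zero}  f = refl
sumℚ≡sum {suc m} f = cong (f fzero +ℚ_) (sumℚ≡sum (f ∘ fsuc))

sumℚ-cong : ∀ {m} {f g : Fin m → ℚ} → (∀ i → f i ≡ g i) → sumℚ f ≡ sumℚ g
sumℚ-cong {zero}  f≗g = refl
sumℚ-cong {suc m} f≗g = cong₂ _+ℚ_ (f≗g fzero) (sumℚ-cong (f≗g ∘ fsuc))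

sumℚ-comm : ∀ {a b} (f : Fin a → Fin b → ℚ) →
            sumℚ (λ i → sumℚ (λ j → f i j)) ≡ sumℚ (λ j → sumℚ (λ i → f i j))
sumℚ-comm f = begin
  sumℚ (λ i → sumℚ (f i))               ≡⟨ sumℚ≡sum (λ i → sumℚ (f i)) ⟩
  ℚΣ.sum (λ i → sumℚ (f i))             ≡⟨ ℚΣ.sum-cong-≗ (λ i → sumℚ≡sum (f i)) ⟩
  ℚΣ.sum (λ i → ℚΣ.sum (f i))           ≡⟨ ℚΣ.∑-comm f ⟩
  ℚΣ.sum (λ j → ℚΣ.sum (λ i → f i j))   ≡⟨ ℚΣ.sum-cong-≗ (λ j → sumℚ≡sum (λ i → f i j)) ⟨
  ℚΣ.sum (λ j → sumℚ (λ i → f i j))     ≡⟨ sumℚ≡sum (λ j → sumℚ (λ i → f i j)) ⟨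
  sumℚ (λ j → sumℚ (λ i → f i j))       ∎
  where open ≡-Reasoning

*-distribˡ-sumℚ : ∀ {m} c (f : Fin m → ℚ) → c *ℚ sumℚ f ≡ sumℚ (λ i → c *ℚ f i)
*-distribˡ-sumℚ c f = begin
  c *ℚ sumℚ f                  ≡⟨ cong (c *ℚ_) (sumℚ≡sum f) ⟩
  c *ℚ ℚΣ.sum f                ≡⟨ ℚΣ.*-distribˡ-sum c f ⟩
  ℚΣ.sum (λ i → c *ℚ f i)      ≡⟨ sumℚ≡sum (λ i → c *ℚ f i) ⟨
  sumℚ (λ i → c *ℚ f i)        ∎
  where open ≡-Reasoning

sumℚ-mono-≤ : ∀ {m} {f g : Fin m → ℚ} → (∀ i → f i ≤ℚ g i) → sumℚ f ≤ℚ sumℚ g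
sumℚ-mono-≤ {zero}  f≤g = ℚP.≤-refl
sumℚ-mono-≤ {suc m} f≤g = ℚP.+-mono-≤ (f≤g fzero) (sumℚ-mono-≤ (f≤g ∘ fsuc))

convex-combination-≤ : ∀ {m} (λs a : Fin m → ℚ) b → (∀ j → 0ℚ ≤ℚ λs j) → sumℚ λs ≡ 1ℚ →
                       (∀ j → a j ≤ℚ b) → sumℚ (λ j → λs j *ℚ a j) ≤ℚ b
convex-combination-≤ λs a b λs≥0 Σλs≡1 a≤b = begin
  sumℚ (λ j → λs j *ℚ a j)  ≤⟨ sumℚ-mono-≤ (λ j → ℚP.*-monoˡ-≤-nonNeg (λs j) {{nonNegative (λs≥0 j)}} (a≤b j)) ⟩
  sumℚ (λ j → λs j *ℚ b)    ≡⟨ sumℚ-cong (λ j → ℚP.*-comm (λs j) b) ⟩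
  sumℚ (λ j → b *ℚ λs j)    ≡⟨ *-distribˡ-sumℚ b λs ⟨
  b *ℚ sumℚ λs              ≡⟨ cong (b *ℚ_) Σλs≡1 ⟩
  b *ℚ 1ℚ                   ≡⟨ ℚP.*-identityʳ b ⟩
  b                         ∎
  where open ℚP.≤-Reasoning

-- Fractions

private
  toℚᵘ-/ : ∀ i m → toℚᵘ (i / suc m) ℚᵘ.≃ mkℚᵘ i m
  toℚᵘ-/ i m = ℚP.toℚᵘ-fromℚᵘ (mkℚᵘ i m)

/≤/⇒*≤* : ∀ i j m n → i / suc m ≤ℚ j / suc n → i ℤ.* + suc n ℤ.≤ j ℤ.* + suc m
/≤/⇒*≤* i j m n i/m≤j/n
  with *≤* i*n≤j*m ← ℚᵘP.≤-respʳ-≃ (toℚᵘ-/ j n) (ℚᵘP.≤-respˡ-≃ (toℚᵘ-/ i m) (ℚP.toℚᵘ-mono-≤ i/m≤j/n))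
  = i*n≤j*m

*≤*⇒/≤/ : ∀ i j m n → i ℤ.* + suc n ℤ.≤ j ℤ.* + suc m → i / suc m ≤ℚ j / suc n
*≤*⇒/≤/ i j m n i*n≤j*m = ℚP.toℚᵘ-cancel-≤
  (ℚᵘP.≤-respʳ-≃ (ℚᵘP.≃-sym (toℚᵘ-/ j n)) (ℚᵘP.≤-respˡ-≃ (ℚᵘP.≃-sym (toℚᵘ-/ i m)) (*≤* i*n≤j*m)))

+/≤+/⇒*≤* : ∀ a b m n → + a / suc m ≤ℚ + b / suc n → a * suc n ≤ b * suc m
+/≤+/⇒*≤* a b m n a/m≤b/n = ℤP.drop‿+≤+
  (subst₂ ℤ._≤_ (sym (ℤP.pos-* a (suc n))) (sym (ℤP.pos-* b (suc m))) (/≤/⇒*≤* (+ a) (+ b) m n a/m≤b/n))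

*≤*⇒+/≤+/ : ∀ a b m n → a * suc n ≤ b * suc m → + a / suc m ≤ℚ + b / suc n
*≤*⇒+/≤+/ a b m n a*n≤b*m =
  *≤*⇒/≤/ (+ a) (+ b) m n (subst₂ ℤ._≤_ (ℤP.pos-* a (suc n)) (ℤP.pos-* b (suc m)) (ℤ.+≤+ a*n≤b*m))

+/-+ : ∀ a b m → + a / suc m +ℚ + b / suc m ≡ + (a + b) / suc m
+/-+ a b m = ℚP.toℚᵘ-injective (ℚᵘP.≃-trans (ℚP.toℚᵘ-homo-+ (+ a / suc m) (+ b / suc m))
  (ℚᵘP.≃-trans (ℚᵘP.+-cong (toℚᵘ-/ (+ a) m) (toℚᵘ-/ (+ b) m))
  (ℚᵘP.≃-trans (*≡* common-denominator) (ℚᵘP.≃-sym (toℚᵘ-/ (+ (a + b)) m)))))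
  where
  s : ℤ
  s = + suc m
  distrib : ∀ i j d → (i ℤ.* d ℤ.+ j ℤ.* d) ℤ.* d ≡ (i ℤ.+ j) ℤ.* (d ℤ.* d)
  distrib = ℤSolver.solve-∀
  common-denominator : (+ a ℤ.* s ℤ.+ + b ℤ.* s) ℤ.* s ≡ + (a + b) ℤ.* + (suc m * suc m)
  common-denominator = trans (distrib (+ a) (+ b) s)
    (cong₂ ℤ._*_ (sym (ℤP.pos-+ a b)) (sym (ℤP.pos-* (suc m) (suc m))))

sumℚ-/ : ∀ {k} (f : Fin k → ℕ) m → sumℚ (λ i → + f i / suc m) ≡ + sum f / suc m
sumℚ-/ {zero}  f m = sym (ℚP.0/n≡0 (suc m))
sumℚ-/ {suc k} f m = trans (cong (_+ℚ_ (+ f fzero / suc m)) (sumℚ-/ (f ∘ fsuc) m))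
                           (+/-+ (f fzero) (sum (f ∘ fsuc)) m)

0≤toℚ⇒≡+∣∣ : ∀ z → 0ℚ ≤ℚ toℚ z → z ≡ + ℤ.∣ z ∣
0≤toℚ⇒≡+∣∣ (+ a)    _   = refl
0≤toℚ⇒≡+∣∣ -[1+ a ] 0≤z with subst (ℤ._≤_ (+ 0)) (ℤP.*-identityʳ -[1+ a ]) (/≤/⇒*≤* (+ 0) -[1+ a ] 0 0 0≤z)
... | ()

-- Integral polytopes

integral-bound : ∀ {n m} {P : (Fin n → ℚ) → Set} (w : Fin m → Fin n) (b : ℚ) → Integral P →
                 (∀ (p : Fin n → ℤ) → P (λ v → toℚ (p v)) → sumℚ (λ i → toℚ (p (w i))) ≤ℚ b) →
                 ∀ x → P x → sumℚ (λ i → x (w i)) ≤ℚ b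
integral-bound w b integral bound x Px
  with _ , p , λs , Pp , λs≥0 , Σλs≡1 , x≡ ← integral x Px = begin
  sumℚ (λ i → x (w i))                                ≡⟨ sumℚ-cong (λ i → x≡ (w i)) ⟩
  sumℚ (λ i → sumℚ (λ j → λs j *ℚ toℚ (p j (w i))))   ≡⟨ sumℚ-comm (λ i j → λs j *ℚ toℚ (p j (w i))) ⟩
  sumℚ (λ j → sumℚ (λ i → λs j *ℚ toℚ (p j (w i))))   ≡⟨ sumℚ-cong (λ j → *-distribˡ-sumℚ (λs j) (λ i → toℚ (p j (w i)))) ⟨
  sumℚ (λ j → λs j *ℚ sumℚ (λ i → toℚ (p j (w i))))   ≤⟨ convex-combination-≤ λs _ b λs≥0 Σλs≡1 (λ j → bound (p j) (Pp j)) ⟩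
  b                                                   ∎
  where open ℚP.≤-Reasoning

-- Positions on a cycle

mod-toℕ : ∀ {K} (i : Fin (suc K)) → toℕ i mod suc K ≡ i
mod-toℕ {K} i = toℕ-injective (trans (toℕ-fromℕ< (m%n<n (toℕ i) (suc K))) (m<n⇒m%n≡m (toℕ<n i)))

mod-self : ∀ K → suc K mod suc K ≡ 0 mod suc K
mod-self K = toℕ-injective (trans (toℕ-fromℕ< (m%n<n (suc K) (suc K)))
               (trans (n%n≡0 (suc K)) (sym (toℕ-fromℕ< (m%n<n 0 (suc K))))))

next : ∀ {K} → Fin (suc K) → Fin (suc K)
next {K} i = suc (toℕ i) mod suc K

shift-next : ∀ {K} (i : Fin (suc K)) → shift i 1 ≡ toℕ (next i)
shift-next {K} i = trans (cong (_% suc K) (ℕP.+-comm (toℕ i) 1))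
                         (sym (toℕ-fromℕ< (m%n<n (suc (toℕ i)) (suc K))))

next-mod : ∀ K t → next (t mod suc K) ≡ suc t mod suc K
next-mod K t = toℕ-injective (begin
  toℕ (next (t mod k))         ≡⟨ toℕ-fromℕ< (m%n<n (suc (toℕ (t mod k))) k) ⟩
  suc (toℕ (t mod k)) % k      ≡⟨ cong (λ r → suc r % k) (toℕ-fromℕ< (m%n<n t k)) ⟩
  suc (t % k) % k              ≡⟨ %-distribˡ-+ 1 (t % k) k ⟩
  (1 % k + t % k % k) % k      ≡⟨ cong (λ r → (1 % k + r) % k) (m%n%n≡m%n t k) ⟩
  (1 % k + t % k) % k          ≡⟨ %-distribˡ-+ 1 t k ⟨
  suc t % k                    ≡⟨ toℕ-fromℕ< (m%n<n (suc t) k) ⟨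
  toℕ (suc t mod k)            ∎)
  where
  open ≡-Reasoning
  k : ℕ
  k = suc K

shift-1-cases : ∀ {K} (i j : Fin (suc K)) → shift i 1 ≡ toℕ j →
                toℕ j ≡ suc (toℕ i) ⊎ (toℕ i ≡ K × toℕ j ≡ 0)
shift-1-cases {K} i j i→j with toℕ i ℕP.<? K
... | yes i<K = inj₁ (trans (sym i→j) (trans (m<n⇒m%n≡m (s≤s (subst (_≤ K) (ℕP.+-comm 1 (toℕ i)) i<K)))
                                              (ℕP.+-comm (toℕ i) 1)))
... | no i≮K  = inj₂ (i≡K , trans (sym i→j) (trans (cong (λ r → (r + 1) % suc K) i≡K)
                                                   (trans (cong (_% suc K) (ℕP.+-comm K 1)) (n%n≡0 (suc K)))))
  where
  i≡K : toℕ i ≡ K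
  i≡K = ℕP.≤-antisym (ℕP.≤-pred (toℕ<n i)) (ℕP.≮⇒≥ i≮K)

%-cancelʳ-+ : ∀ K x y z → (x + z) % suc K ≡ (y + z) % suc K → x % suc K ≡ y % suc K
%-cancelʳ-+ K x y z x+z≡y+z =
  trans (unshift x) (trans (cong (λ r → (r + z * K % k) % k) x+z≡y+z) (sym (unshift y)))
  where
  k : ℕ
  k = suc K
  unshift : ∀ w → w % k ≡ ((w + z) % k + z * K % k) % k
  unshift w = begin
    w % k                            ≡⟨ [m+kn]%n≡m%n w z k ⟨
    (w + z * k) % k                  ≡⟨ cong (λ r → (w + r) % k) (ℕP.*-suc z K) ⟩
    (w + (z + z * K)) % k            ≡⟨ cong (_% k) (ℕP.+-assoc w z (z * K)) ⟨
    (w + z + z * K) % k              ≡⟨ %-distribˡ-+ (w + z) (z * K) k ⟩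
    ((w + z) % k + z * K % k) % k    ∎
    where open ≡-Reasoning

-- Homomorphisms between cycles

odd-cycle-not-bipartite : ∀ {k} → Odd k → (χ : Fin k → Parity) →
                          (∀ i j → CycAdj k i j → χ j ≡ χ i ⁻¹) → ⊥
odd-cycle-not-bipartite {suc K} odd-k χ proper =
  ℙP.p≢p⁻¹ (χ (0 mod k)) (trans (cong χ (sym (mod-self K))) (walk k odd-k))
  where
  k : ℕ
  k = suc K
  step : ∀ t → χ (suc t mod k) ≡ χ (t mod k) ⁻¹
  step t = proper (t mod k) (suc t mod k) (inj₁ (trans (shift-next (t mod k)) (cong toℕ (next-mod K t))))
  walk : ∀ d → Odd d → χ (d mod k) ≡ χ (0 mod k) ⁻¹
  walk (suc zero)    _     = step 0
  walk (suc (suc d)) odd-d =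
    trans (step (suc d)) (trans (cong _⁻¹ (step d)) (trans (ℙP.⁻¹-involutive _) (walk d odd-d)))

parity-suc : ∀ n → parity (suc n) ≡ parity n ⁻¹
parity-suc n = sym (ℙP.⁻¹-selfInverse (ℙP.suc-homo-⁻¹ n))

-- Cutting the cycle open at m: the positions before m are moved up by k, so that the
-- cycle minus m becomes a path in ℕ.
unroll : ∀ {k} → Fin k → Fin k → ℕ
unroll {k} m i with toℕ i ℕP.<? toℕ m
... | yes _ = k + toℕ i
... | no _  = toℕ i

unroll-step : ∀ {K} (m i j : Fin (suc K)) → i ≢ m → j ≢ m → shift i 1 ≡ toℕ j →
              unroll m j ≡ suc (unroll m i)
unroll-step {K} m i j i≢m j≢m i→j
  with shift-1-cases i j i→j | toℕ i ℕP.<? toℕ m | toℕ j ℕP.<? toℕ m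
... | inj₁ j≡1+i | yes _   | yes _   = trans (cong (_+_ (suc K)) j≡1+i) (ℕP.+-suc (suc K) (toℕ i))
... | inj₁ j≡1+i | no _    | no _    = j≡1+i
... | inj₁ j≡1+i | yes i<m | no j≮m  =
  ⊥-elim (j≢m (toℕ-injective (ℕP.≤-antisym (subst (_≤ toℕ m) (sym j≡1+i) i<m) (ℕP.≮⇒≥ j≮m))))
... | inj₁ j≡1+i | no i≮m  | yes j<m =
  ⊥-elim (i≮m (ℕP.<-trans (subst (toℕ i <_) (sym j≡1+i) (ℕP.n<1+n (toℕ i))) j<m))
... | inj₂ (i≡K , j≡0) | no _    | yes _   =
  trans (cong (_+_ (suc K)) j≡0) (trans (ℕP.+-identityʳ (suc K)) (cong suc (sym i≡K)))
... | inj₂ (i≡K , j≡0) | yes i<m | _       =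
  ⊥-elim (ℕP.<-irrefl refl (ℕP.<-≤-trans (subst (_< toℕ m) i≡K i<m) (ℕP.≤-pred (toℕ<n m))))
... | inj₂ (i≡K , j≡0) | no _    | no j≮m  =
  ⊥-elim (j≢m (toℕ-injective (trans j≡0 (sym (ℕP.n≤0⇒n≡0 (subst (toℕ m ≤_) j≡0 (ℕP.≮⇒≥ j≮m)))))))

<⇒∃-∉-image : ∀ {m n} → m < n → (f : Fin m → Fin n) → ∃ λ y → ¬ (∃ λ x → f x ≡ y)
<⇒∃-∉-image {m} {n} m<n f = ¬∀⟶∃¬ n (λ y → ∃ λ x → f x ≡ y) (λ y → any? (λ x → f x ≟ y)) ¬surjective
  where
  ¬surjective : ¬ (∀ y → ∃ λ x → f x ≡ y)
  ¬surjective surj = ℕP.<⇒≱ m<n (injective⇒≤ {f = proj₁ ∘ surj}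
    (λ {y} {y'} e → trans (sym (proj₂ (surj y))) (trans (cong f e) (proj₂ (surj y')))))

cycle-hom-length : ∀ {k k'} → Odd k' → (p : Fin k' → Fin k) →
                   (∀ i j → CycAdj k' i j → CycAdj k (p i) (p j)) → k ≤ k'
cycle-hom-length {zero}  odd-k' p hom = z≤n
cycle-hom-length {suc K} {k'} odd-k' p hom with suc K ℕP.≤? k'
... | yes k≤k' = k≤k'
... | no k≰k'  = ⊥-elim (odd-cycle-not-bipartite odd-k' χ proper)
  where
  missed : ∃ λ m → ¬ (∃ λ i → p i ≡ m)
  missed = <⇒∃-∉-image (ℕP.≰⇒> k≰k') p
  m : Fin (suc K)
  m = proj₁ missed
  p≢m : ∀ i → p i ≢ m
  p≢m i pi≡m = proj₂ missed (i , pi≡m)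
  χ : Fin k' → Parity
  χ i = parity (unroll m (p i))
  flip : ∀ i j → shift (p i) 1 ≡ toℕ (p j) → χ j ≡ χ i ⁻¹
  flip i j pi→pj = trans (cong parity (unroll-step m (p i) (p j) (p≢m i) (p≢m j) pi→pj))
                         (parity-suc (unroll m (p i)))
  proper : ∀ i j → CycAdj k' i j → χ j ≡ χ i ⁻¹
  proper i j ij with hom i j ij
  ... | inj₁ pi→pj = flip i j pi→pj
  ... | inj₂ pj→pi = sym (ℙP.⁻¹-selfInverse (sym (flip j i pj→pi)))

-- Stable sets of a cycle and odd segments

odd-gap⇒adjacent-zeros : (b : ℕ → ℕ) → (∀ t → b t + b (suc t) ≤ 1) →
                          ∀ d → Odd d → b 0 ≡ 0 → b d ≡ 0 → ∃ λ s → s < d × b s + b (suc s) ≡ 0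
odd-gap⇒adjacent-zeros b stable (suc zero)    _     b0≡0 b1≡0 = 0 , s≤s z≤n , cong₂ _+_ b0≡0 b1≡0
odd-gap⇒adjacent-zeros b stable (suc (suc d)) odd-d b0≡0 bd≡0 with b 1 in b1≡
... | zero  = 0 , s≤s z≤n , cong₂ _+_ b0≡0 b1≡
... | suc r
  with b2≡0 ← ℕP.n≤0⇒n≡0 (ℕP.m+n≤o⇒n≤o r (ℕP.≤-pred (subst (λ t → t + b 2 ≤ 1) b1≡ (stable 1))))
  with s , s<d , bs≡0 ← odd-gap⇒adjacent-zeros (λ t → b (2 + t)) (λ t → stable (2 + t)) d odd-d b2≡0 bd≡0
  = 2 + s , s≤s (s≤s s<d) , bs≡0

module OddSegments {K : ℕ} (S : Fin (suc K) → Bool) (B : Fin (suc K) → ℕ)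
  (B-stable : ∀ i j → CycAdj (suc K) i j → B i + B j ≤ 1)
  (B-avoids-S : ∀ i → S i ≡ true → B i ≡ 0) where

  private
    k : ℕ
    k = suc K

  pos : Fin k → ℕ → Fin k
  pos a t = (toℕ a + t) mod k

  toℕ-pos : ∀ a t → toℕ (pos a t) ≡ shift a t
  toℕ-pos a t = toℕ-fromℕ< (m%n<n (toℕ a + t) k)

  next-pos : ∀ a t → next (pos a t) ≡ pos a (suc t)
  next-pos a t = trans (next-mod K (toℕ a + t)) (cong (_mod k) (sym (ℕP.+-suc (toℕ a) t)))

  E : Fin k → ℕ
  E i = B i + B (next i)

  E≤1 : ∀ i → E i ≤ 1
  E≤1 i = B-stable i (next i) (inj₁ (shift-next i))

  sum-E : sum E ≡ sum B * 2
  sum-E = begin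
    sum E                    ≡⟨ ∑-distrib-+ B (B ∘ next) ⟩
    sum B + sum (B ∘ next)   ≡⟨ cong (_+_ (sum B)) sum-B∘next ⟩
    sum B + sum B            ≡⟨ cong (_+_ (sum B)) (ℕP.+-identityʳ (sum B)) ⟨
    sum B + (sum B + 0)      ≡⟨ ℕP.*-comm 2 (sum B) ⟩
    sum B * 2                ∎
    where
    open ≡-Reasoning
    g : ℕ → ℕ
    g t = B (t mod k)
    sum-B : sum {k} (λ i → g (toℕ i)) ≡ sum B
    sum-B = sum-cong-≗ (λ i → cong B (mod-toℕ i))
    sum-B∘next : sum (B ∘ next) ≡ sum B
    sum-B∘next = trans (ℕP.+-cancelˡ-≡ (g 0) _ _ (begin
      g 0 + sum (B ∘ next)               ≡⟨ sum-rotate k g ⟩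
      sum {k} (λ i → g (toℕ i)) + g k    ≡⟨ cong (_+_ (sum {k} (λ i → g (toℕ i)))) (cong B (mod-self K)) ⟩
      sum {k} (λ i → g (toℕ i)) + g 0    ≡⟨ ℕP.+-comm _ (g 0) ⟩
      g 0 + sum {k} (λ i → g (toℕ i))    ∎)) sum-B

  pos-0 : ∀ a → pos a 0 ≡ a
  pos-0 a = trans (cong (_mod k) (ℕP.+-identityʳ (toℕ a))) (mod-toℕ a)

  zero-in-segment : ∀ a d → S a ≡ true → Odd d → (∃ λ j → toℕ j ≡ shift a d × S j ≡ true) →
                    ∃ λ s → s < d × E (pos a s) ≡ 0
  zero-in-segment a d Sa odd-d (j , j≡a+d , Sj) =
    let s , s<d , bs+bs'≡0 = odd-gap⇒adjacent-zeros b b-stable d odd-d b0≡0 bd≡0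
    in  s , s<d , trans (cong (λ i → B (pos a s) + B i) (next-pos a s)) bs+bs'≡0
    where
    b : ℕ → ℕ
    b t = B (pos a t)
    b-stable : ∀ t → b t + b (suc t) ≤ 1
    b-stable t = subst (λ i → b t + B i ≤ 1) (next-pos a t) (E≤1 (pos a t))
    b0≡0 : b 0 ≡ 0
    b0≡0 = trans (cong B (pos-0 a)) (B-avoids-S a Sa)
    bd≡0 : b d ≡ 0
    bd≡0 = trans (cong B (toℕ-injective (trans (toℕ-pos a d) (sym j≡a+d)))) (B-avoids-S j Sj)

  SegmentInterior : Fin k → ℕ → Set
  SegmentInterior a d = ∀ e → 1 ≤ e → e < d → ∀ j → toℕ j ≡ shift a e → S j ≡ false

  S-in-segment⇒start : ∀ a d → SegmentInterior a d → ∀ u → u < d → S (pos a u) ≡ true → pos a u ≡ a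
  S-in-segment⇒start a d interior zero    _   _       = pos-0 a
  S-in-segment⇒start a d interior (suc u) u<d S≡true with () ←
    trans (sym S≡true) (interior (suc u) (s≤s z≤n) u<d (pos a (suc u)) (toℕ-pos a (suc u)))

  same-position⇒same-start : ∀ a a' d → SegmentInterior a d → S a' ≡ true →
                     ∀ s s' → s < d → s' ≤ s → pos a s ≡ pos a' s' → a ≡ a'
  same-position⇒same-start a a' d interior Sa' s s' s<d s'≤s as≡a's' =
    trans (sym (S-in-segment⇒start a d interior u u<d (subst (λ i → S i ≡ true) (sym au≡a') Sa'))) au≡a'
    where
    u : ℕ
    u = s ∸ s'
    u<d : u < d
    u<d = ℕP.≤-<-trans (ℕP.m∸n≤m s s') s<d
    au+s'≡a'+s' : (toℕ a + u + s') % k ≡ (toℕ a' + s') % k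
    au+s'≡a'+s' = begin
      (toℕ a + u + s') % k      ≡⟨ cong (_% k) (ℕP.+-assoc (toℕ a) u s') ⟩
      (toℕ a + (u + s')) % k    ≡⟨ cong (λ r → (toℕ a + r) % k) (ℕP.m∸n+n≡m s'≤s) ⟩
      (toℕ a + s) % k           ≡⟨ toℕ-pos a s ⟨
      toℕ (pos a s)             ≡⟨ cong toℕ as≡a's' ⟩
      toℕ (pos a' s')           ≡⟨ toℕ-pos a' s' ⟩
      (toℕ a' + s') % k         ∎
      where open ≡-Reasoning
    au≡a' : pos a u ≡ a'
    au≡a' = toℕ-injective (trans (toℕ-pos a u)
              (trans (%-cancelʳ-+ K (toℕ a + u) (toℕ a') s' au+s'≡a'+s') (m<n⇒m%n≡m (toℕ<n a'))))

  segments-disjoint : ∀ a a' d d' → SegmentInterior a d → SegmentInterior a' d' →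
                      S a ≡ true → S a' ≡ true →
                      ∀ s s' → s < d → s' < d' → pos a s ≡ pos a' s' → a ≡ a'
  segments-disjoint a a' d d' int int' Sa Sa' s s' s<d s'<d' eq with ℕP.≤-total s' s
  ... | inj₁ s'≤s = same-position⇒same-start a a' d int Sa' s s' s<d s'≤s eq
  ... | inj₂ s≤s' = sym (same-position⇒same-start a' a d' int' Sa s' s s'<d' s≤s' (sym eq))

  zero-of : ∀ {a} → OddSegmentAt S a → Fin k
  zero-of {a} (Sa , d , _ , odd-d , end , _) = pos a (proj₁ (zero-in-segment a d Sa odd-d end))

  E-zero-of : ∀ {a} (seg : OddSegmentAt S a) → E (zero-of seg) ≡ 0
  E-zero-of {a} (Sa , d , _ , odd-d , end , _) = proj₂ (proj₂ (zero-in-segment a d Sa odd-d end))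

  zero-of-injective : ∀ {a a'} (seg : OddSegmentAt S a) (seg' : OddSegmentAt S a') →
                      zero-of seg ≡ zero-of seg' → a ≡ a'
  zero-of-injective {a} {a'} (Sa , d , _ , odd-d , end , int) (Sa' , d' , _ , odd-d' , end' , int') =
    segments-disjoint a a' d d' int int' Sa Sa' _ _
      (proj₁ (proj₂ (zero-in-segment a d Sa odd-d end)))
      (proj₁ (proj₂ (zero-in-segment a' d' Sa' odd-d' end')))

  three-odd-segments : AtLeast3 (OddSegmentAt S) → sum B * 2 + 3 ≤ k
  three-odd-segments (a₁ , a₂ , a₃ , a₁≢a₂ , a₁≢a₃ , a₂≢a₃ , seg₁ , seg₂ , seg₃) =
    subst (λ r → r + 3 ≤ k) sum-E (sum+3≤ E E≤1 (zero-of seg₁) (zero-of seg₂) (zero-of seg₃)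
      (a₁≢a₂ ∘ zero-of-injective seg₁ seg₂) (a₁≢a₃ ∘ zero-of-injective seg₁ seg₃)
      (a₂≢a₃ ∘ zero-of-injective seg₂ seg₃)
      (E-zero-of seg₁) (E-zero-of seg₂) (E-zero-of seg₃))

-- The loose odd wheel

module LooseOddWheel {n : ℕ} (G : Graph n) {K : ℕ} (c : Fin (suc K) → Fin n) (h : Fin n)
  (cycle : InducedCycle G (suc K) c) (odd-k : Odd (suc K)) (h∉c : ∀ i → h ≢ c i)
  (odd-segments : AtLeast3 (OddSegmentAt (λ i → adj G h (c i)))) where

  private
    k : ℕ
    k = suc K

  wheel : Fin (suc k) → Fin n
  wheel fzero    = h
  wheel (fsuc i) = c i

  OnCycle : Fin n → Set
  OnCycle v = ∃ λ i → c i ≡ v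

  weight : Fin n → ℕ
  weight v with v ≟ h | any? (λ i → c i ≟ v)
  ... | yes _ | _     = 2
  ... | no _  | yes _ = K
  ... | no _  | no _  = 0

  2≤K : 2 ≤ K
  2≤K = ℕP.≤-pred (proj₁ cycle)

  weight≤K : ∀ v → weight v ≤ K
  weight≤K v with v ≟ h | any? (λ i → c i ≟ v)
  ... | yes _ | _     = 2≤K
  ... | no _  | yes _ = ℕP.≤-refl
  ... | no _  | no _  = z≤n

  weight-off-cycle : ∀ v → ¬ OnCycle v → weight v ≤ 2
  weight-off-cycle v v∉c with v ≟ h | any? (λ i → c i ≟ v)
  ... | yes _ | _        = ℕP.≤-refl
  ... | no _  | yes v∈c  = ⊥-elim (v∉c v∈c)
  ... | no _  | no _     = z≤n

  weight-c : ∀ i → weight (c i) ≡ K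
  weight-c i with c i ≟ h | any? (λ j → c j ≟ c i)
  ... | yes ci≡h | _     = ⊥-elim (h∉c i (sym ci≡h))
  ... | no _     | yes _ = refl
  ... | no _     | no ci∉c = ⊥-elim (ci∉c (i , refl))

  weight-h : weight h ≡ 2
  weight-h with h ≟ h
  ... | yes _   = refl
  ... | no h≢h  = ⊥-elim (h≢h refl)

  weight-on-odd-cycle : ∀ k' (c' : Fin k' → Fin n) → InducedCycle G k' c' → Odd k' →
                        sum (weight ∘ c') ≤ (k' ∸ 1) * k
  weight-on-odd-cycle (suc k'') c' (3≤k' , _ , c'-adj) odd-k'
    with all? (λ i → any? (λ j → c j ≟ c' i))
  ... | yes c'⊆c = ℕP.≤-trans (sum-≤-* (weight ∘ c') K (weight≤K ∘ c'))
    (subst (suc k'' * K ≤_) (sym (ℕP.*-suc k'' K)) (ℕP.+-monoˡ-≤ (k'' * K) (ℕP.≤-pred k≤k')))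
    where
    p : Fin (suc k'') → Fin k
    p i = proj₁ (c'⊆c i)
    c∘p≡c' : ∀ i → c (p i) ≡ c' i
    c∘p≡c' i = proj₂ (c'⊆c i)
    hom : ∀ i j → CycAdj (suc k'') i j → CycAdj k (p i) (p j)
    hom i j ij = Equivalence.to (proj₂ (proj₂ cycle) (p i) (p j))
      (subst₂ (λ u v → adj G u v ≡ true) (sym (c∘p≡c' i)) (sym (c∘p≡c' j)) (Equivalence.from (c'-adj i j) ij))
    k≤k' : k ≤ suc k''
    k≤k' = cycle-hom-length odd-k' p hom
  ... | no c'⊈c with i , c'i∉c ← ¬∀⟶∃¬ (suc k'') _ (λ i → any? (λ j → c j ≟ c' i)) c'⊈c =
    ℕP.≤-trans (sum-≤-+* (weight ∘ c') i 2 K (weight-off-cycle (c' i) c'i∉c) (weight≤K ∘ c'))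
      (subst (2 + k'' * K ≤_) (sym (ℕP.*-suc k'' K)) (ℕP.+-monoˡ-≤ (k'' * K) (ℕP.≤-pred 3≤k')))

  -- suc (K + k) = 2k
  x : Fin n → ℚ
  x v = + weight v / suc (K + k)

  x∈TSTAB : InTSTAB G x
  x∈TSTAB = x≥0 , x-edge , x-odd-cycle
    where
    x≥0 : ∀ v → 0ℚ ≤ℚ x v
    x≥0 v = *≤*⇒+/≤+/ 0 (weight v) 0 (K + k) z≤n
    x-edge : ∀ u v → adj G u v ≡ true → x u +ℚ x v ≤ℚ 1ℚ
    x-edge u v _ = subst (_≤ℚ 1ℚ) (sym (+/-+ (weight u) (weight v) (K + k)))
      (*≤*⇒+/≤+/ (weight u + weight v) 1 (K + k) 0 (begin
        (weight u + weight v) * 1   ≡⟨ ℕP.*-identityʳ _ ⟩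
        weight u + weight v         ≤⟨ ℕP.+-mono-≤ (weight≤K u) (weight≤K v) ⟩
        K + K                       ≤⟨ ℕP.+-monoʳ-≤ K (ℕP.n≤1+n K) ⟩
        K + k                       ≤⟨ ℕP.n≤1+n (K + k) ⟩
        suc (K + k)                 ≡⟨ ℕP.*-identityˡ _ ⟨
        1 * suc (K + k)             ∎))
      where open ℕP.≤-Reasoning
    x-odd-cycle : ∀ k' (c' : Fin k' → Fin n) → InducedCycle G k' c' → Odd k' →
                  sumℚ (λ i → x (c' i)) ≤ℚ + (k' ∸ 1) / 2
    x-odd-cycle k' c' c'-cycle odd-k' = subst (_≤ℚ + (k' ∸ 1) / 2) (sym (sumℚ-/ (weight ∘ c') (K + k)))
      (*≤*⇒+/≤+/ (sum (weight ∘ c')) (k' ∸ 1) (K + k) 1 (begin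
        sum (weight ∘ c') * 2       ≤⟨ ℕP.*-monoˡ-≤ 2 (weight-on-odd-cycle k' c' c'-cycle odd-k') ⟩
        (k' ∸ 1) * k * 2            ≡⟨ double (k' ∸ 1) K ⟩
        (k' ∸ 1) * suc (K + k)      ∎))
      where
      open ℕP.≤-Reasoning
      double : ∀ a K → a * suc K * 2 ≡ a * suc (K + suc K)
      double = solve-∀

  hub-neighbour : ∃ λ i → adj G h (c i) ≡ true
  hub-neighbour = let a , _ , _ , _ , _ , _ , (h~ca , _) , _ = odd-segments in a , h~ca

  stable-set-bound : (b : Fin n → ℕ) → (∀ u v → adj G u v ≡ true → b u + b v ≤ 1) →
                     sum (b ∘ c) * 2 ≤ K → (b h + sum (b ∘ c)) * 2 ≤ K
  stable-set-bound b b-stable cycle-bound with b h in bh≡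
  ... | zero        = cycle-bound
  ... | suc zero    = ℕP.≤-pred (subst (_≤ k) (rearrange (sum (b ∘ c)))
    (OddSegments.three-odd-segments (λ i → adj G h (c i)) (b ∘ c) b∘c-stable b∘c-avoids odd-segments))
    where
    rearrange : ∀ s → s * 2 + 3 ≡ suc ((1 + s) * 2)
    rearrange = solve-∀
    b∘c-stable : ∀ i j → CycAdj k i j → b (c i) + b (c j) ≤ 1
    b∘c-stable i j ij = b-stable (c i) (c j) (Equivalence.from (proj₂ (proj₂ cycle) i j) ij)
    b∘c-avoids : ∀ i → adj G h (c i) ≡ true → b (c i) ≡ 0
    b∘c-avoids i h~ci = ℕP.n≤0⇒n≡0 (ℕP.≤-pred (subst (λ r → r + b (c i) ≤ 1) bh≡ (b-stable h (c i) h~ci)))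
  ... | suc (suc _)
    with () ← ℕP.≤-pred (subst (λ t → t + b (c (proj₁ hub-neighbour)) ≤ 1) bh≡
                                (b-stable h (c (proj₁ hub-neighbour)) (proj₂ hub-neighbour)))

  integer-points-bound : (q : Fin n → ℤ) → InTSTAB G (λ v → toℚ (q v)) →
                         sumℚ (λ i → toℚ (q (wheel i))) ≤ℚ + K / 2
  integer-points-bound q (q≥0 , q-edge , q-odd-cycle) =
    subst (_≤ℚ + K / 2) (sym (sum-q wheel))
      (*≤*⇒+/≤+/ (sum (b ∘ wheel)) K 0 1
        (subst ((b h + sum (b ∘ c)) * 2 ≤_) (sym (ℕP.*-identityʳ K))
          (stable-set-bound b b-stable cycle-bound)))
    where
    b : Fin n → ℕ
    b v = ℤ.∣ q v ∣
    q≡b : ∀ v → toℚ (q v) ≡ + b v / 1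
    q≡b v = cong (_/ 1) (0≤toℚ⇒≡+∣∣ (q v) (q≥0 v))
    sum-q : ∀ {m} (f : Fin m → Fin n) → sumℚ (λ i → toℚ (q (f i))) ≡ + sum (b ∘ f) / 1
    sum-q f = trans (sumℚ-cong (q≡b ∘ f)) (sumℚ-/ (b ∘ f) 0)
    b-stable : ∀ u v → adj G u v ≡ true → b u + b v ≤ 1
    b-stable u v u~v = subst (_≤ 1) (ℕP.*-identityʳ _) (+/≤+/⇒*≤* (b u + b v) 1 0 0
      (subst (_≤ℚ 1ℚ) (trans (cong₂ _+ℚ_ (q≡b u) (q≡b v)) (+/-+ (b u) (b v) 0)) (q-edge u v u~v)))
    cycle-bound : sum (b ∘ c) * 2 ≤ K
    cycle-bound = subst (sum (b ∘ c) * 2 ≤_) (ℕP.*-identityʳ K) (+/≤+/⇒*≤* (sum (b ∘ c)) K 0 1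
      (subst (_≤ℚ + K / 2) (sum-q c) (q-odd-cycle k c cycle odd-k)))

  x-violates : ¬ (sumℚ (λ i → x (wheel i)) ≤ℚ + K / 2)
  x-violates x≤K/2 = ℕP.m+1+n≰m (K * suc (K + k)) (subst (_≤ K * suc (K + k)) (excess K)
    (subst (λ w → w * 2 ≤ K * suc (K + k)) sum-weight
      (+/≤+/⇒*≤* (sum (weight ∘ wheel)) K (K + k) 1
        (subst (_≤ℚ + K / 2) (sumℚ-/ (weight ∘ wheel) (K + k)) x≤K/2))))
    where
    excess : ∀ K → (2 + suc K * K) * 2 ≡ K * suc (K + suc K) + 4
    excess = solve-∀
    sum-weight : sum (weight ∘ wheel) ≡ 2 + k * K
    sum-weight = cong₂ _+_ weight-h (trans (sum-cong-≗ weight-c) (sum-const k K))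

lemma4 : ∀ (n : ℕ) (G : Graph n) → ContainsLooseOddWheel G → ¬ TPerfect G
-- The three hub neighbours required by the definition are the starts of the three odd segments.
lemma4 n G (suc K , c , h , cycle , odd-k , h∉c , _ , odd-segments) integral =
  x-violates (integral-bound wheel (+ K / 2) integral integer-points-bound x x∈TSTAB)
  where open LooseOddWheel G c h cycle odd-k h∉c odd-segments
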